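{- Let $G$ be a graph with $\alpha(G)>|G|/2$ and let $\mathcal{F}$ be the family of all maximum stable sets of $G$. Then $$\left|\bigcap_{S\in\mathcal{F}}S\right|\ge\delta(G)+2\alpha(G)-|G|\ge\delta(G)+1.$$ Moreover, if $\bigcap_{S\in\mathcal{F}}S=\{u\}$, then $\alpha(G)=(|G|+1)/2$ and $u$ is an isolated vertex of $G$.
   Context: Graphs are finite and simple. A set of vertices is stable if it induces no edges; $\alpha(G)$ is the maximum size of a stable set, $|G|$ is the number of vertices, and $\delta(G)$ is the minimum degree. -}

module Defs where

open import Data.Nat using (ℕ; _≤_)
open import Data.Bool using (Bool; true; false)
open import Data.Fin using (Fin)
open import Data.Fin.Subset using (Subset; _∈_; ∣_∣)
open import Data.Vec using (tabulate)
open import Data.Product using (Σ; _×_)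
open import Relation.Binary.PropositionalEquality using (_≡_)

record Graph (n : ℕ) : Set where
  field
    adj    : Fin n → Fin n → Bool
    sym    : ∀ u v → adj u v ≡ adj v u
    irrefl : ∀ u → adj u u ≡ false

open Graph public

Stable : ∀ {n} → Graph n → Subset n → Set
Stable G S = ∀ u v → u ∈ S → v ∈ S → adj G u v ≡ false

MaxStable : ∀ {n} → Graph n → Subset n → Set
MaxStable G S = Stable G S × (∀ T → Stable G T → ∣ T ∣ ≤ ∣ S ∣)

IsAlpha : ∀ {n} → Graph n → ℕ → Set
IsAlpha G a = Σ (Subset _) (λ S → MaxStable G S × ∣ S ∣ ≡ a)

degree : ∀ {n} → Graph n → Fin n → ℕ
degree G u = ∣ tabulate (adj G u) ∣

IsMinDegree : ∀ {n} → Graph n → ℕ → Set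
IsMinDegree G d = Σ (Fin _) (λ u → degree G u ≡ d) × (∀ v → d ≤ degree G v)

IsCore : ∀ {n} → Graph n → Subset n → Set
IsCore G C = ∀ u → (u ∈ C → ∀ S → MaxStable G S → u ∈ S)
                 × ((∀ S → MaxStable G S → u ∈ S) → u ∈ C)

module Submission where

-- Let α = α(G), let C be the core (the intersection of all maximum stable
-- sets), and call X anticomplete to Y when no vertex of X is adjacent to a
-- vertex of Y.  Exchange step: if I ⊆ U, I is anticomplete to U and T is a
-- maximum stable set, then (U ∩ T) ∪ (I ∖ T) is stable, whence the pair
-- (I ∩ T, U ∪ T) has the same properties and |I ∩ T| + |U ∪ T| ≥ |I| + |U|.
-- Starting from (S, S) for a maximum stable set S and intersecting with
-- maximum stable sets that miss vertices of I ∖ C, we shrink I to C and get a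
-- set U anticomplete to C with |C| + |U| ≥ 2α.  The neighbourhood of a core
-- vertex w is disjoint from U, so deg w + 2α ≤ |C| + |G|; this yields both
-- inequalities (C ≠ ∅ since 2α > |G|) and, when C = {u}, 2α = |G| + 1 and
-- deg u = 0.  The core is given only by its defining property, so the sets T
-- exist under a double negation, which the decidable conclusions discharge.

open import Defs hiding (sym)
open import Data.Nat using (ℕ; zero; suc; _+_; _*_; _≤_; _<_; s≤s; _≤?_)
open import Data.Nat.Properties
open import Data.Nat.Tactic.RingSolver using (solve-∀)
open import Data.Bool using (true; false)
open import Data.Fin using (Fin)
open import Data.Fin.Properties using (any?)
open import Data.Fin.Subset
open import Data.Fin.Subset.Properties
open import Data.Vec using ([]; _∷_; tabulate; here; there)
open import Data.Vec.Properties using ([]=⇒lookup; lookup∘tabulate)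
open import Data.Product using (_×_; _,_; proj₁; proj₂; ∃)
open import Data.Sum using (inj₁; inj₂)
open import Relation.Nullary using (¬_; yes; no; contradiction)
open import Relation.Nullary.Decidable using (decidable-stable; _×-dec_; ¬?)
open import Relation.Nullary.Negation using (¬¬-map)
open import Relation.Binary.PropositionalEquality
  using (_≡_; refl; sym; trans; cong; cong₂; subst; module ≡-Reasoning)

∣p∩q∣+∣p─q∣≡∣p∣ : ∀ {n} (p q : Subset n) → ∣ p ∩ q ∣ + ∣ p ─ q ∣ ≡ ∣ p ∣
∣p∩q∣+∣p─q∣≡∣p∣ []          []          = refl
∣p∩q∣+∣p─q∣≡∣p∣ (true ∷ p)  (true ∷ q)  = cong suc (∣p∩q∣+∣p─q∣≡∣p∣ p q)
∣p∩q∣+∣p─q∣≡∣p∣ (true ∷ p)  (false ∷ q) = trans (+-suc _ _) (cong suc (∣p∩q∣+∣p─q∣≡∣p∣ p q))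
∣p∩q∣+∣p─q∣≡∣p∣ (false ∷ p) (true ∷ q)  = ∣p∩q∣+∣p─q∣≡∣p∣ p q
∣p∩q∣+∣p─q∣≡∣p∣ (false ∷ p) (false ∷ q) = ∣p∩q∣+∣p─q∣≡∣p∣ p q

∣p∪q∣+∣p∩q∣≡∣p∣+∣q∣ : ∀ {n} (p q : Subset n) → ∣ p ∪ q ∣ + ∣ p ∩ q ∣ ≡ ∣ p ∣ + ∣ q ∣
∣p∪q∣+∣p∩q∣≡∣p∣+∣q∣ []          []          = refl
∣p∪q∣+∣p∩q∣≡∣p∣+∣q∣ (true ∷ p)  (true ∷ q)  =
  cong suc (trans (+-suc _ _) (trans (cong suc (∣p∪q∣+∣p∩q∣≡∣p∣+∣q∣ p q)) (sym (+-suc _ _))))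
∣p∪q∣+∣p∩q∣≡∣p∣+∣q∣ (true ∷ p)  (false ∷ q) = cong suc (∣p∪q∣+∣p∩q∣≡∣p∣+∣q∣ p q)
∣p∪q∣+∣p∩q∣≡∣p∣+∣q∣ (false ∷ p) (true ∷ q)  =
  trans (cong suc (∣p∪q∣+∣p∩q∣≡∣p∣+∣q∣ p q)) (sym (+-suc _ _))
∣p∪q∣+∣p∩q∣≡∣p∣+∣q∣ (false ∷ p) (false ∷ q) = ∣p∪q∣+∣p∩q∣≡∣p∣+∣q∣ p q

disjoint-∣p∪q∣ : ∀ {n} (p q : Subset n) → (∀ x → x ∈ p → x ∉ q) → ∣ p ∪ q ∣ ≡ ∣ p ∣ + ∣ q ∣
disjoint-∣p∪q∣ {n} p q disjoint = begin
  ∣ p ∪ q ∣              ≡⟨ sym (+-identityʳ _) ⟩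
  ∣ p ∪ q ∣ + 0          ≡⟨ cong (∣ p ∪ q ∣ +_) (sym ∣p∩q∣≡0) ⟩
  ∣ p ∪ q ∣ + ∣ p ∩ q ∣  ≡⟨ ∣p∪q∣+∣p∩q∣≡∣p∣+∣q∣ p q ⟩
  ∣ p ∣ + ∣ q ∣          ∎
  where
  open ≡-Reasoning
  ∣p∩q∣≡0 : ∣ p ∩ q ∣ ≡ 0
  ∣p∩q∣≡0 = trans (cong ∣_∣ (Empty-unique λ { (x , x∈p∩q) →
    let (x∈p , x∈q) = x∈p∩q⁻ p q x∈p∩q in disjoint x x∈p x∈q })) (∣⊥∣≡0 n)

disjoint-size : ∀ {n} (p q : Subset n) → (∀ x → x ∈ p → x ∉ q) → ∣ p ∣ + ∣ q ∣ ≤ n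
disjoint-size p q disjoint = subst (_≤ _) (disjoint-∣p∪q∣ p q disjoint) (∣p∣≤n (p ∪ q))

x∈p─q⇒x∉q : ∀ {n} {x : Fin n} (p q : Subset n) → x ∈ p ─ q → x ∉ q
x∈p─q⇒x∉q (_ ∷ p) (true ∷ q)  ()         here
x∈p─q⇒x∉q (_ ∷ p) (false ∷ q) here       ()
x∈p─q⇒x∉q (_ ∷ p) (_ ∷ q)     (there x∈) (there x∈q) = x∈p─q⇒x∉q p q x∈ x∈q

-- X is anticomplete to Y: no vertex of X is adjacent to a vertex of Y.
-- The sets may overlap; a set anticomplete to itself is exactly a stable set.
Anticomplete : ∀ {n} → Graph n → Subset n → Subset n → Set
Anticomplete G X Y = ∀ x y → x ∈ X → y ∈ Y → adj G x y ≡ false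

neighbourhood : ∀ {n} → Graph n → Fin n → Subset n
neighbourhood G w = tabulate (adj G w)

∈-neighbourhood : ∀ {n} (G : Graph n) {w y : Fin n} → y ∈ neighbourhood G w → adj G w y ≡ true
∈-neighbourhood G {w} {y} y∈N = trans (sym (lookup∘tabulate (adj G w) y)) ([]=⇒lookup y∈N)

degree-bound : ∀ {n} (G : Graph n) (w : Fin n) (U : Subset n) →
  (∀ y → y ∈ U → adj G w y ≡ false) → degree G w + ∣ U ∣ ≤ n
degree-bound G w U w≁U = disjoint-size (neighbourhood G w) U disjoint
  where
  disjoint : ∀ y → y ∈ neighbourhood G w → y ∉ U
  disjoint y y∈N y∈U with trans (sym (∈-neighbourhood G y∈N)) (w≁U y y∈U)
  ... | ()

module Exchange {n} (G : Graph n) {I U T : Subset n}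
                (I⊆U : I ⊆ U) (I≁U : Anticomplete G I U) where

  traded : Subset n
  traded = (U ∩ T) ∪ (I ─ T)

  traded-stable : Stable G T → Stable G traded
  traded-stable T-stable x y x∈ y∈
    with x∈p∪q⁻ (U ∩ T) (I ─ T) x∈ | x∈p∪q⁻ (U ∩ T) (I ─ T) y∈
  ... | inj₁ x∈U∩T | inj₁ y∈U∩T =
    T-stable x y (proj₂ (x∈p∩q⁻ U T x∈U∩T)) (proj₂ (x∈p∩q⁻ U T y∈U∩T))
  ... | inj₁ x∈U∩T | inj₂ y∈I─T =
    trans (Graph.sym G x y) (I≁U y x (p─q⊆p I T y∈I─T) (proj₁ (x∈p∩q⁻ U T x∈U∩T)))
  ... | inj₂ x∈I─T | inj₁ y∈U∩T = I≁U x y (p─q⊆p I T x∈I─T) (proj₁ (x∈p∩q⁻ U T y∈U∩T))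
  ... | inj₂ x∈I─T | inj₂ y∈I─T = I≁U x y (p─q⊆p I T x∈I─T) (I⊆U (p─q⊆p I T y∈I─T))

  ∣traded∣ : ∣ traded ∣ ≡ ∣ U ∩ T ∣ + ∣ I ─ T ∣
  ∣traded∣ = disjoint-∣p∪q∣ (U ∩ T) (I ─ T)
    λ x x∈U∩T x∈I─T → x∈p─q⇒x∉q I T x∈I─T (proj₂ (x∈p∩q⁻ U T x∈U∩T))

  -- Since |traded| ≤ |T|, replacing (I, U) by (I ∩ T, U ∪ T) does not
  -- decrease |I| + |U|.
  exchange : MaxStable G T → ∣ I ∣ + ∣ U ∣ ≤ ∣ I ∩ T ∣ + ∣ U ∪ T ∣
  exchange (T-stable , T-maximum) = +-cancelʳ-≤ (∣ T ∣) _ _ (begin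
    ∣ I ∣ + ∣ U ∣ + ∣ T ∣
      ≡⟨ +-assoc (∣ I ∣) (∣ U ∣) (∣ T ∣) ⟩
    ∣ I ∣ + (∣ U ∣ + ∣ T ∣)
      ≡⟨ cong₂ _+_ (sym (∣p∩q∣+∣p─q∣≡∣p∣ I T)) (sym (∣p∪q∣+∣p∩q∣≡∣p∣+∣q∣ U T)) ⟩
    (∣ I ∩ T ∣ + ∣ I ─ T ∣) + (∣ U ∪ T ∣ + ∣ U ∩ T ∣)
      ≡⟨ regroup (∣ I ∩ T ∣) (∣ I ─ T ∣) (∣ U ∪ T ∣) (∣ U ∩ T ∣) ⟩
    ∣ I ∩ T ∣ + ∣ U ∪ T ∣ + (∣ U ∩ T ∣ + ∣ I ─ T ∣)
      ≡⟨ cong (∣ I ∩ T ∣ + ∣ U ∪ T ∣ +_) (sym ∣traded∣) ⟩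
    ∣ I ∩ T ∣ + ∣ U ∪ T ∣ + ∣ traded ∣
      ≤⟨ +-monoʳ-≤ (∣ I ∩ T ∣ + ∣ U ∪ T ∣) (T-maximum traded (traded-stable T-stable)) ⟩
    ∣ I ∩ T ∣ + ∣ U ∪ T ∣ + ∣ T ∣ ∎)
    where
    open ≤-Reasoning
    regroup : ∀ a b c d → (a + b) + (c + d) ≡ a + c + (d + b)
    regroup = solve-∀

  exchange-anticomplete : Stable G T → Anticomplete G (I ∩ T) (U ∪ T)
  exchange-anticomplete T-stable x y x∈I∩T y∈U∪T with x∈p∩q⁻ I T x∈I∩T | x∈p∪q⁻ U T y∈U∪T
  ... | x∈I , _   | inj₁ y∈U = I≁U x y x∈I y∈U
  ... | _   , x∈T | inj₂ y∈T = T-stable x y x∈T y∈T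

module ShrinkToCore {n} (G : Graph n) (C : Subset n) (core : IsCore G C) where

  record Approximation (m : ℕ) (I U : Subset n) : Set where
    field
      core⊆I       : C ⊆ I
      I⊆U          : I ⊆ U
      anticomplete : Anticomplete G I U
      weight       : m ≤ ∣ I ∣ + ∣ U ∣

  CorePartner : ℕ → Set
  CorePartner m = ∃ λ U → Anticomplete G C U × m ≤ ∣ C ∣ + ∣ U ∣

  avoiding : ∀ {v} → v ∉ C → ¬ ¬ (∃ λ T → MaxStable G T × v ∉ T)
  avoiding {v} v∉C no-T = v∉C (proj₂ (core v) λ S S-max →
    decidable-stable (v ∈? S) (λ v∉S → no-T (S , S-max , v∉S)))

  refine : ∀ {m I U T} → Approximation m I U → MaxStable G T → Approximation m (I ∩ T) (U ∪ T)
  refine {I = I} {U} {T} A T-max = record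
    { core⊆I       = λ {x} x∈C → x∈p∩q⁺ (core⊆I x∈C , proj₁ (core x) x∈C T T-max)
    ; I⊆U          = λ x∈I∩T → q⊆p∪q U T (proj₂ (x∈p∩q⁻ I T x∈I∩T))
    ; anticomplete = exchange-anticomplete (proj₁ T-max)
    ; weight       = ≤-trans weight (exchange T-max)
    }
    where
    open Approximation A
    open Exchange G I⊆U anticomplete

  -- While I ⊈ C, refine with a maximum stable set missing a vertex of I ∖ C;
  -- this strictly decreases |I|, which stays below the bound k.
  shrink : ∀ {m} k I U → ∣ I ∣ < k → Approximation m I U → ¬ ¬ CorePartner m
  shrink zero    I U ()    A
  shrink {m} (suc k) I U ∣I∣<k A with any? (λ x → x ∈? I ×-dec ¬? (x ∈? C))
  ... | no nothing-outside = λ no-partner → no-partner (U , C≁U , weight-C)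
    where
    open Approximation A
    I⊆C : I ⊆ C
    I⊆C {x} x∈I = decidable-stable (x ∈? C) (λ x∉C → nothing-outside (x , x∈I , x∉C))
    C≁U : Anticomplete G C U
    C≁U x y x∈C = anticomplete x y (core⊆I x∈C)
    weight-C : m ≤ ∣ C ∣ + ∣ U ∣
    weight-C = ≤-trans weight (+-monoˡ-≤ (∣ U ∣) (p⊆q⇒∣p∣≤∣q∣ I⊆C))
  ... | yes (v , v∈I , v∉C) = λ no-partner → avoiding v∉C λ { (T , T-max , v∉T) →
        shrink k (I ∩ T) (U ∪ T) (smaller T v∉T) (refine A T-max) no-partner }
    where
    smaller : ∀ T → v ∉ T → ∣ I ∩ T ∣ < k
    smaller T v∉T = <-≤-trans
      (p⊂q⇒∣p∣<∣q∣ (p∩q⊆p I T , v , v∈I , λ v∈I∩T → v∉T (proj₂ (x∈p∩q⁻ I T v∈I∩T))))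
      (≤-pred ∣I∣<k)

  core-partner : ∀ {S} → MaxStable G S → ¬ ¬ CorePartner (∣ S ∣ + ∣ S ∣)
  core-partner {S} S-max = shrink (suc n) S S (s≤s (∣p∣≤n S)) record
    { core⊆I       = λ {x} x∈C → proj₁ (core x) x∈C S S-max
    ; I⊆U          = λ x∈S → x∈S
    ; anticomplete = proj₁ S-max
    ; weight       = ≤-refl
    }

  core-size : ∀ {S} → MaxStable G S → ∣ S ∣ + ∣ S ∣ ≤ ∣ C ∣ + n
  core-size S-max = decidable-stable (_ ≤? _) (¬¬-map bound (core-partner S-max))
    where
    bound : ∀ {m} → CorePartner m → m ≤ ∣ C ∣ + n
    bound (U , _ , weight) = ≤-trans weight (+-monoʳ-≤ (∣ C ∣) (∣p∣≤n U))

  core-degree : ∀ {S w} → MaxStable G S → w ∈ C → degree G w + (∣ S ∣ + ∣ S ∣) ≤ ∣ C ∣ + n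
  core-degree {S} {w} S-max w∈C =
    decidable-stable (_ ≤? _) (¬¬-map bound (core-partner S-max))
    where
    bound : ∀ {m} → CorePartner m → degree G w + m ≤ ∣ C ∣ + n
    bound {m} (U , C≁U , weight) = begin
      degree G w + m                ≤⟨ +-monoʳ-≤ (degree G w) weight ⟩
      degree G w + (∣ C ∣ + ∣ U ∣)  ≡⟨ rearrange (degree G w) (∣ C ∣) (∣ U ∣) ⟩
      ∣ C ∣ + (degree G w + ∣ U ∣)  ≤⟨ +-monoʳ-≤ (∣ C ∣) (degree-bound G w U (λ y → C≁U w y w∈C)) ⟩
      ∣ C ∣ + n                     ∎
      where
      open ≤-Reasoning
      rearrange : ∀ a b c → a + (b + c) ≡ b + (a + c)
      rearrange = solve-∀

  core-nonempty : ∀ {S} → MaxStable G S → n < ∣ S ∣ + ∣ S ∣ → Nonempty C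
  core-nonempty S-max n<2∣S∣ with nonempty? C
  ... | yes C-nonempty = C-nonempty
  ... | no  C-empty    = contradiction
    (subst (λ c → _ ≤ c + n) (trans (cong ∣_∣ (Empty-unique C-empty)) (∣⊥∣≡0 n)) (core-size S-max))
    (<⇒≱ n<2∣S∣)

exactly-one : ∀ {n} (C : Subset n) (u : Fin n) → (∀ v → (v ∈ C → v ≡ u) × (v ≡ u → v ∈ C)) → ∣ C ∣ ≡ 1
exactly-one C u members = trans (cong ∣_∣ C≡⁅u⁆) (∣⁅x⁆∣≡1 u)
  where
  C≡⁅u⁆ : C ≡ ⁅ u ⁆
  C≡⁅u⁆ = ⊆-antisym (λ {x} x∈C → subst (_∈ ⁅ u ⁆) (sym (proj₁ (members x) x∈C)) (x∈⁅x⁆ u))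
                    (λ {x} x∈⁅u⁆ → proj₂ (members x) (x∈⁅y⁆⇒x≡y u x∈⁅u⁆))

squeeze : ∀ D A n → D + A ≤ 1 + n → n < A → (A ≡ n + 1) × (D ≡ 0)
squeeze D A n D+A≤1+n n<A = A≡n+1 , D≡0
  where
  A≡n+1 : A ≡ n + 1
  A≡n+1 = trans (≤-antisym (≤-trans (m≤n+m A D) D+A≤1+n) n<A) (+-comm 1 n)
  D≡0 : D ≡ 0
  D≡0 = n≤0⇒n≡0 (+-cancelʳ-≤ A D 0 (≤-trans D+A≤1+n n<A))

lemma3p2 : ∀ {n} (G : Graph n) (a d : ℕ) (C : Subset n) →
    IsAlpha G a → IsMinDegree G d → n < 2 * a → IsCore G C →
    ((d + 2 * a ≤ ∣ C ∣ + n) × (d + 1 + n ≤ d + 2 * a))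
    × (∀ (u : Fin n) → (∀ v → (v ∈ C → v ≡ u) × (v ≡ u → v ∈ C)) →
         (2 * a ≡ n + 1) × (degree G u ≡ 0))
lemma3p2 {n} G _ d C (S , S-max , refl) (_ , d-minimum) n<2α core =
  (core-lower-bound , strict) , singleton-core
  where
  open ShrinkToCore G C core
  2α≡α+α : 2 * ∣ S ∣ ≡ ∣ S ∣ + ∣ S ∣
  2α≡α+α = cong (∣ S ∣ +_) (+-identityʳ (∣ S ∣))
  n<α+α : n < ∣ S ∣ + ∣ S ∣
  n<α+α = subst (n <_) 2α≡α+α n<2α

  core-lower-bound : d + 2 * ∣ S ∣ ≤ ∣ C ∣ + n
  core-lower-bound with core-nonempty S-max n<α+α
  ... | w , w∈C = subst (λ t → d + t ≤ ∣ C ∣ + n) (sym 2α≡α+α)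
    (≤-trans (+-monoˡ-≤ (∣ S ∣ + ∣ S ∣) (d-minimum w)) (core-degree S-max w∈C))

  strict : d + 1 + n ≤ d + 2 * ∣ S ∣
  strict = subst (_≤ d + 2 * ∣ S ∣) (sym (+-assoc d 1 n)) (+-monoʳ-≤ d n<2α)

  singleton-core : ∀ u → (∀ v → (v ∈ C → v ≡ u) × (v ≡ u → v ∈ C)) →
                   (2 * ∣ S ∣ ≡ n + 1) × (degree G u ≡ 0)
  singleton-core u members =
    let (α+α≡n+1 , deg≡0) = squeeze (degree G u) (∣ S ∣ + ∣ S ∣) n
          (subst (λ c → degree G u + (∣ S ∣ + ∣ S ∣) ≤ c + n) (exactly-one C u members)
                 (core-degree S-max (proj₂ (members u) refl)))
          n<α+α
    in trans 2α≡α+α α+α≡n+1 , deg≡0
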